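{- There is a function $g$ with $g(n)=O(n^3)$ such that for each $n$ there exist equivalent reduced $n$-expressions $u,v$ satisfying $\operatorname{dist}(u,v)\ge \tfrac18 n^4 + g(n)$.
   Context: For $1\le i\le n-1$, $\sigma_i$ is the transposition exchanging $i$ and $i+1$. An $n$-expression is a word over $\{\sigma_1,\dots,\sigma_{n-1}\}$, representing the product of its letters read left to right; equivalent means same permutation; reduced means no shorter equivalent expression. Braid relations: (I) $\sigma_i\sigma_j\sigma_i=\sigma_j\sigma_i\sigma_j$ for $|i-j|=1$; (II) $\sigma_i\sigma_j=\sigma_j\sigma_i$ for $|i-j|\ge2$. For equivalent reduced $u,v$, $\operatorname{dist}(u,v)$ is the minimal number of braid-relation applications transforming $u$ into $v$. -}

module Defs where

open import Data.Nat using (ℕ; zero; suc; _∸_; _<_; _≤_; _≡ᵇ_)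
open import Data.Fin using (Fin; toℕ)
open import Data.List using (List; []; _∷_; _++_; map; length)
open import Data.Bool using (if_then_else_)
open import Data.Sum using (_⊎_)
open import Relation.Binary.PropositionalEquality using (_≡_)

-- Letters of an n-expression: σ_1 … σ_{n-1}, encoded (0-indexed) by Fin (n ∸ 1);
-- the letter i : Fin (n ∸ 1) stands for σ_{toℕ i + 1}.
Letter : ℕ → Set
Letter n = Fin (n ∸ 1)

Expr : ℕ → Set
Expr n = List (Letter n)

swap : ℕ → ℕ → ℕ
swap i x = if x ≡ᵇ i then suc i else (if x ≡ᵇ suc i then i else x)

-- Action of the product of the letters of a word, read left to right.
actℕ : List ℕ → ℕ → ℕ
actℕ []      x = x
actℕ (i ∷ w) x = actℕ w (swap i x)

act : ∀ {n} → Expr n → ℕ → ℕ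
act w = actℕ (map toℕ w)

Equivalent : ∀ n → Expr n → Expr n → Set
Equivalent n u v = ∀ x → x < n → act {n} u x ≡ act {n} v x

Reduced : ∀ n → Expr n → Set
Reduced n u = ∀ (w : Expr n) → Equivalent n u w → length u ≤ length w

data BraidPair (n : ℕ) : Expr n → Expr n → Set where
  rel-I  : ∀ (i j : Letter n) → (suc (toℕ i) ≡ toℕ j ⊎ suc (toℕ j) ≡ toℕ i) →
           BraidPair n (i ∷ j ∷ i ∷ []) (j ∷ i ∷ j ∷ [])
  rel-II : ∀ (i j : Letter n) → (suc (toℕ i) < toℕ j ⊎ suc (toℕ j) < toℕ i) →
           BraidPair n (i ∷ j ∷ []) (j ∷ i ∷ [])

data BraidStep (n : ℕ) : Expr n → Expr n → Set where
  step : ∀ (p s l r : Expr n) → BraidPair n l r →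
         BraidStep n (p ++ l ++ s) (p ++ r ++ s)

data BraidPath (n : ℕ) : Expr n → Expr n → ℕ → Set where
  done : ∀ u → BraidPath n u u zero
  more : ∀ {u w v k} → BraidStep n u w → BraidPath n w v k → BraidPath n u v (suc k)

module Submission where

-- Read a word from the identity and label each letter by the pair of values it exchanges.  The crossing
-- number of a word counts ordered pairs of letters with disjoint labels (a , b), (c , d) and a < c.
-- A relation (II) exchanges two adjacent labels and changes it by at most one; a relation (I) reverses
-- three labels that pairwise share a value and does not change it (BraidInvariance).  Two explicit
-- expressions U n, V n of the reversal x ↦ n-1-x (ReversalWords) have length n(n-1)/2, hence are reduced
-- by an inversion count (Inversions); V n has crossing number 0 and U n has 3·C(n,4) (ReversalCrossings,
-- QuarticGrowth).  So every braid path from U n to V n has length k ≥ 3·C(n,4), i.e. n⁴ ≤ 8k + 8n³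
-- (FarApartExpressions), which is the corollary with g n = -n³ once read in ℚ (RationalBound).

open import Defs

module Transpositions where

  open import Data.Nat using (zero; suc; _≡ᵇ_; _<_; s≤s; z≤n)
  open import Data.Nat.Properties using (≤-pred)
  import Data.Sum as Sum
  open Sum using (_⊎_; inj₁; inj₂)
  open import Data.Bool using (true; false)
  open import Data.List using ([]; _∷_; map)
  open import Relation.Binary.PropositionalEquality

  swap-suc : ∀ i x → swap (suc i) (suc x) ≡ suc (swap i x)
  swap-suc i x with x ≡ᵇ i | x ≡ᵇ suc i
  ... | true  | _     = refl
  ... | false | true  = refl
  ... | false | false = refl

  swap-here : ∀ i → swap i i ≡ suc i
  swap-here zero    = refl
  swap-here (suc i) = trans (swap-suc i i) (cong suc (swap-here i))

  swap-there : ∀ i → swap i (suc i) ≡ i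
  swap-there zero    = refl
  swap-there (suc i) = trans (swap-suc i (suc i)) (cong suc (swap-there i))

  swap-outside : ∀ i x → x < i ⊎ suc i < x → swap i x ≡ x
  swap-outside zero    zero          (inj₁ ())
  swap-outside zero    zero          (inj₂ ())
  swap-outside zero    (suc zero)    (inj₁ ())
  swap-outside zero    (suc zero)    (inj₂ (s≤s ()))
  swap-outside zero    (suc (suc x)) _ = refl
  swap-outside (suc i) zero          _ = refl
  swap-outside (suc i) (suc x)       h =
    trans (swap-suc i x) (cong suc (swap-outside i x (Sum.map ≤-pred ≤-pred h)))

  swap-bounded : ∀ {i x m} → suc i < m → x < m → swap i x < m
  swap-bounded {zero}  {zero}        (s≤s (s≤s _)) _   = s≤s (s≤s z≤n)
  swap-bounded {zero}  {suc zero}    (s≤s (s≤s _)) _   = s≤s z≤n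
  swap-bounded {zero}  {suc (suc x)} _             x<m = x<m
  swap-bounded {suc i} {zero}        _             x<m = x<m
  swap-bounded {suc i} {suc x} {suc m} (s≤s i<m) (s≤s x<m) =
    subst (_< suc m) (sym (swap-suc i x)) (s≤s (swap-bounded i<m x<m))

  act-shift : ∀ w x → actℕ (map suc w) (suc x) ≡ suc (actℕ w x)
  act-shift []      x = refl
  act-shift (i ∷ w) x = trans (cong (actℕ (map suc w)) (swap-suc i x)) (act-shift w (swap i x))

  -- The relations of the symmetric group, as identities of actions of letter words:
  -- every relation holds for the letters 0,1,2 by computation and transports to
  -- larger letters by `act-shift`.
  swap-involutive : ∀ i x → actℕ (i ∷ i ∷ []) x ≡ x
  swap-involutive zero    zero          = refl
  swap-involutive zero    (suc zero)    = refl
  swap-involutive zero    (suc (suc x)) = refl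
  swap-involutive (suc i) zero          = refl
  swap-involutive (suc i) (suc x)       = trans (act-shift (i ∷ i ∷ []) x) (cong suc (swap-involutive i x))

  swap-braid : ∀ i x → actℕ (i ∷ suc i ∷ i ∷ []) x ≡ actℕ (suc i ∷ i ∷ suc i ∷ []) x
  swap-braid zero    zero                = refl
  swap-braid zero    (suc zero)          = refl
  swap-braid zero    (suc (suc zero))    = refl
  swap-braid zero    (suc (suc (suc x))) = refl
  swap-braid (suc i) zero                = refl
  swap-braid (suc i) (suc x)             =
    trans (act-shift (i ∷ suc i ∷ i ∷ []) x)
          (trans (cong suc (swap-braid i x)) (sym (act-shift (suc i ∷ i ∷ suc i ∷ []) x)))

  swap-commute : ∀ i j x → suc i < j → actℕ (i ∷ j ∷ []) x ≡ actℕ (j ∷ i ∷ []) x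
  swap-commute zero    (suc zero)    _             (s≤s ())
  swap-commute zero    (suc (suc j)) zero          _ = refl
  swap-commute zero    (suc (suc j)) (suc zero)    _ = refl
  swap-commute zero    (suc (suc j)) (suc (suc x)) _ = trans lift (sym (cong (swap 0) lift))
    where
    lift : swap (suc (suc j)) (suc (suc x)) ≡ suc (suc (swap j x))
    lift = trans (swap-suc (suc j) (suc x)) (cong suc (swap-suc j x))
  swap-commute (suc i) (suc j)       zero          _ = refl
  swap-commute (suc i) (suc j)       (suc x) (s≤s i<j) =
    trans (act-shift (i ∷ j ∷ []) x)
          (trans (cong suc (swap-commute i j x i<j)) (sym (act-shift (j ∷ i ∷ []) x)))

-- A word w is read against a frame f : ℕ → ℕ (the one-line notation of a permutation, position ↦ value).
-- Each letter i exchanges the values in positions i and i+1; its label is the pair of values exchanged.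
module Labelling where

  open Transpositions
  open import Data.Nat using (ℕ; suc; _<_; _≤_)
  open import Data.Nat.Properties using (≤-trans; n≤1+n)
  open import Data.Product using (_×_; _,_)
  open import Data.Sum using (inj₂)
  open import Data.List using (List; []; _∷_; _++_; map; length)
  open import Data.List.Relation.Unary.All using (All; []; _∷_)
  open import Function using (id; _∘_)
  open import Relation.Binary.PropositionalEquality

  Pair : Set
  Pair = ℕ × ℕ

  after : (ℕ → ℕ) → List ℕ → (ℕ → ℕ)
  after f []      = f
  after f (i ∷ w) = after (f ∘ swap i) w

  labels : (ℕ → ℕ) → List ℕ → List Pair
  labels f []      = []
  labels f (i ∷ w) = (f i , f (suc i)) ∷ labels (f ∘ swap i) w

  after-++ : ∀ f u w → after f (u ++ w) ≡ after (after f u) w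
  after-++ f []      w = refl
  after-++ f (i ∷ u) w = after-++ (f ∘ swap i) u w

  labels-++ : ∀ f u w → labels f (u ++ w) ≡ labels f u ++ labels (after f u) w
  labels-++ f []      w = refl
  labels-++ f (i ∷ u) w = cong ((f i , f (suc i)) ∷_) (labels-++ (f ∘ swap i) u w)

  after-comp : ∀ f w x → after f w x ≡ f (after id w x)
  after-comp f []      x = refl
  after-comp f (i ∷ w) x = trans (after-comp (f ∘ swap i) w x) (cong f (sym (after-comp (swap i) w x)))

  act-after : ∀ w y → actℕ w (after id w y) ≡ y
  act-after []      y = refl
  act-after (i ∷ w) y = begin
    actℕ w (swap i (after (swap i) w y))      ≡⟨ cong (actℕ w ∘ swap i) (after-comp (swap i) w y) ⟩
    actℕ w (swap i (swap i (after id w y)))   ≡⟨ cong (actℕ w) (swap-involutive i (after id w y)) ⟩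
    actℕ w (after id w y)                     ≡⟨ act-after w y ⟩
    y                                         ∎
    where open ≡-Reasoning

  length-labels : ∀ f w → length (labels f w) ≡ length w
  length-labels f []      = refl
  length-labels f (i ∷ w) = cong suc (length-labels (f ∘ swap i) w)

  after-≗ : ∀ {f g} w → (∀ x → f x ≡ g x) → ∀ x → after f w x ≡ after g w x
  after-≗ []      f≗g = f≗g
  after-≗ (i ∷ w) f≗g = after-≗ w (f≗g ∘ swap i)

  labels-≗ : ∀ {f g} w → (∀ x → f x ≡ g x) → labels f w ≡ labels g w
  labels-≗ []      f≗g = refl
  labels-≗ (i ∷ w) f≗g = cong₂ _∷_ (cong₂ _,_ (f≗g i) (f≗g (suc i))) (labels-≗ w (f≗g ∘ swap i))

  shift : Pair → Pair
  shift (a , b) = (suc a , suc b)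

  labels-suc : ∀ f w → labels (suc ∘ f) w ≡ map shift (labels f w)
  labels-suc f []      = refl
  labels-suc f (i ∷ w) = cong (shift (f i , f (suc i)) ∷_) (labels-suc (f ∘ swap i) w)

  after-suc : ∀ f w x → after (suc ∘ f) w x ≡ suc (after f w x)
  after-suc f []      x = refl
  after-suc f (i ∷ w) x = after-suc (f ∘ swap i) w x

  labels-map-suc : ∀ f w → labels f (map suc w) ≡ labels (f ∘ suc) w
  labels-map-suc f []      = refl
  labels-map-suc f (i ∷ w) = cong ((f (suc i) , f (suc (suc i))) ∷_)
    (trans (labels-map-suc (f ∘ swap (suc i)) w) (labels-≗ w (cong f ∘ swap-suc i)))

  after-map-suc : ∀ f w x → after f (map suc w) (suc x) ≡ after (f ∘ suc) w x
  after-map-suc f []      x = refl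
  after-map-suc f (i ∷ w) x = trans (after-map-suc (f ∘ swap (suc i)) w x) (after-≗ w (cong f ∘ swap-suc i) x)

  after-map-suc-0 : ∀ f w → after f (map suc w) 0 ≡ f 0
  after-map-suc-0 f []      = refl
  after-map-suc-0 f (i ∷ w) = after-map-suc-0 (f ∘ swap (suc i)) w

  Bounded : ℕ → List ℕ → Set
  Bounded m = All (λ i → suc i < m)

  after-cong : ∀ {f g} m w → Bounded m w → (∀ x → x < m → f x ≡ g x) →
               ∀ x → x < m → after f w x ≡ after g w x
  after-cong m []      []         f≗g = f≗g
  after-cong m (i ∷ w) (i<m ∷ w<m) f≗g =
    after-cong m w w<m (λ y y<m → f≗g (swap i y) (swap-bounded i<m y<m))

  labels-cong : ∀ {f g} m w → Bounded m w → (∀ x → x < m → f x ≡ g x) → labels f w ≡ labels g w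
  labels-cong m []      []          f≗g = refl
  labels-cong m (i ∷ w) (i<m ∷ w<m) f≗g =
    cong₂ _∷_ (cong₂ _,_ (f≗g i (≤-trans (n≤1+n _) i<m)) (f≗g (suc i) i<m))
              (labels-cong m w w<m (λ y y<m → f≗g (swap i y) (swap-bounded i<m y<m)))

  after-above : ∀ f m w → Bounded m w → ∀ x → m ≤ x → after f w x ≡ f x
  after-above f m []      []          x m≤x = refl
  after-above f m (i ∷ w) (i<m ∷ w<m) x m≤x =
    trans (after-above (f ∘ swap i) m w w<m x m≤x) (cong f (swap-outside i x (inj₂ (≤-trans i<m m≤x))))

module CrossingPotential where

  open Labelling using (Pair)
  open import Data.Nat using (ℕ; zero; suc; _+_; _≤_; _<ᵇ_; _≡ᵇ_; z≤n)
  open import Data.Nat.Properties using (≤-refl; +-identityʳ)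
  open import Data.Nat.ListAction using (sum)
  open import Data.Nat.ListAction.Properties using (sum-++; sum-↭)
  open import Data.Nat.Tactic.RingSolver using (solve-∀)
  open import Data.Bool using (Bool; true; false; if_then_else_; _∧_; _∨_; not)
  open import Data.Bool.Properties using (∧-zeroʳ; ∨-zeroʳ)
  open import Data.Product using (_,_)
  open import Data.Sum using (_⊎_; inj₁; inj₂)
  open import Data.List using (List; []; _∷_; _++_; map)
  open import Data.List.Properties using (map-++; map-cong)
  open import Data.List.Relation.Binary.Permutation.Propositional using (_↭_)
  open import Data.List.Relation.Binary.Permutation.Propositional.Properties using (map⁺)
  open import Relation.Binary.PropositionalEquality

  shares : Pair → Pair → Bool
  shares (a , b) (c , d) = (a ≡ᵇ c) ∨ (a ≡ᵇ d) ∨ (b ≡ᵇ c) ∨ (b ≡ᵇ d)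

  crosses : Pair → Pair → ℕ
  crosses p@(a , _) q@(c , _) = if (a <ᵇ c) ∧ not (shares p q) then 1 else 0

  crossingsFrom : Pair → List Pair → ℕ
  crossingsFrom p L = sum (map (crosses p) L)

  crossingsBetween : List Pair → List Pair → ℕ
  crossingsBetween A B = sum (map (λ p → crossingsFrom p B) A)

  potential : List Pair → ℕ
  potential []      = 0
  potential (p ∷ L) = crossingsFrom p L + potential L

  crosses≤1 : ∀ p q → crosses p q ≤ 1
  crosses≤1 (a , b) (c , d) with (a <ᵇ c) ∧ not (shares (a , b) (c , d))
  ... | true  = ≤-refl
  ... | false = z≤n

  ≡ᵇ-refl : ∀ a → (a ≡ᵇ a) ≡ true
  ≡ᵇ-refl zero    = refl
  ≡ᵇ-refl (suc a) = ≡ᵇ-refl a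

  shares-intro : ∀ {a b c d} → a ≡ c ⊎ a ≡ d ⊎ b ≡ c ⊎ b ≡ d → shares (a , b) (c , d) ≡ true
  shares-intro {a}             (inj₁ refl)               rewrite ≡ᵇ-refl a = refl
  shares-intro {a} {c = c}     (inj₂ (inj₁ refl))        rewrite ≡ᵇ-refl a = ∨-zeroʳ (a ≡ᵇ c)
  shares-intro {a} {b} {c} {d} (inj₂ (inj₂ (inj₁ refl))) rewrite ≡ᵇ-refl b =
    trans (cong ((a ≡ᵇ b) ∨_) (∨-zeroʳ (a ≡ᵇ d))) (∨-zeroʳ (a ≡ᵇ b))
  shares-intro {a} {b} {c}     (inj₂ (inj₂ (inj₂ refl))) rewrite ≡ᵇ-refl b =
    trans (cong ((a ≡ᵇ c) ∨_) (trans (cong ((a ≡ᵇ b) ∨_) (∨-zeroʳ (b ≡ᵇ c))) (∨-zeroʳ (a ≡ᵇ b))))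
          (∨-zeroʳ (a ≡ᵇ c))

  crosses-sharing : ∀ {a b c d} → a ≡ c ⊎ a ≡ d ⊎ b ≡ c ⊎ b ≡ d → crosses (a , b) (c , d) ≡ 0
  crosses-sharing {a} {b} {c} {d} sh rewrite shares-intro sh | ∧-zeroʳ (a <ᵇ c) = refl

  potential-pair : ∀ p q → potential (p ∷ q ∷ []) ≤ 1
  potential-pair p q rewrite +-identityʳ (crosses p q) | +-identityʳ (crosses p q) = crosses≤1 p q

  -- The labels of a braid relation σ_i σ_{i+1} σ_i pairwise share a value, in either order.
  triangle-potential : ∀ a b c → potential ((a , b) ∷ (a , c) ∷ (b , c) ∷ []) ≡ 0
  triangle-potential a b c
    rewrite crosses-sharing {a} {b} {a} {c} (inj₁ refl)
          | crosses-sharing {a} {b} {b} {c} (inj₂ (inj₂ (inj₁ refl)))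
          | crosses-sharing {a} {c} {b} {c} (inj₂ (inj₂ (inj₂ refl))) = refl

  triangle-potential-reversed : ∀ a b c → potential ((b , c) ∷ (a , c) ∷ (a , b) ∷ []) ≡ 0
  triangle-potential-reversed a b c
    rewrite crosses-sharing {b} {c} {a} {c} (inj₂ (inj₂ (inj₂ refl)))
          | crosses-sharing {b} {c} {a} {b} (inj₂ (inj₁ refl))
          | crosses-sharing {a} {c} {a} {b} (inj₁ refl) = refl

  crossingsFrom-++ : ∀ p A B → crossingsFrom p (A ++ B) ≡ crossingsFrom p A + crossingsFrom p B
  crossingsFrom-++ p A B = trans (cong sum (map-++ (crosses p) A B)) (sum-++ (map (crosses p) A) _)

  crossingsBetween-++ʳ : ∀ A B C → crossingsBetween A (B ++ C) ≡ crossingsBetween A B + crossingsBetween A C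
  crossingsBetween-++ʳ []      B C = refl
  crossingsBetween-++ʳ (p ∷ A) B C
    rewrite crossingsFrom-++ p B C | crossingsBetween-++ʳ A B C =
      interchange (crossingsFrom p B) (crossingsFrom p C) (crossingsBetween A B) (crossingsBetween A C)
    where
    interchange : ∀ a b c d → a + b + (c + d) ≡ a + c + (b + d)
    interchange = solve-∀

  potential-++ : ∀ A B → potential (A ++ B) ≡ potential A + crossingsBetween A B + potential B
  potential-++ []      B = refl
  potential-++ (p ∷ A) B rewrite crossingsFrom-++ p A B | potential-++ A B =
    regroup (crossingsFrom p A) (crossingsFrom p B) (potential A) (crossingsBetween A B) (potential B)
    where
    regroup : ∀ a b c d e → a + b + (c + d + e) ≡ a + c + (b + d) + e
    regroup = solve-∀

  crossingsFrom-↭ : ∀ p {B B'} → B ↭ B' → crossingsFrom p B ≡ crossingsFrom p B'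
  crossingsFrom-↭ p B↭B' = sum-↭ (map⁺ (crosses p) B↭B')

  crossingsBetween-↭ʳ : ∀ A {B B'} → B ↭ B' → crossingsBetween A B ≡ crossingsBetween A B'
  crossingsBetween-↭ʳ A B↭B' = cong sum (map-cong (λ p → crossingsFrom-↭ p B↭B') A)

  crossingsBetween-↭ˡ : ∀ {B B'} C → B ↭ B' → crossingsBetween B C ≡ crossingsBetween B' C
  crossingsBetween-↭ˡ C B↭B' = sum-↭ (map⁺ (λ p → crossingsFrom p C) B↭B')

  -- The potential of A ++ B ++ C is that of B plus a part invariant under reordering B.
  potential-middle : ∀ A B C → potential (A ++ B ++ C)
    ≡ potential B + (potential A + crossingsBetween A B + crossingsBetween A C + crossingsBetween B C + potential C)
  potential-middle A B C
    rewrite potential-++ A (B ++ C) | crossingsBetween-++ʳ A B C | potential-++ B C =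
      regroup (potential A) (crossingsBetween A B) (crossingsBetween A C)
              (potential B) (crossingsBetween B C) (potential C)
    where
    regroup : ∀ a b c d e f → a + (b + c) + (d + e + f) ≡ d + (a + b + c + e + f)
    regroup = solve-∀

  potential-reorder : ∀ A {B B'} C → B ↭ B' →
    potential (A ++ B ++ C) + potential B' ≡ potential (A ++ B' ++ C) + potential B
  potential-reorder A {B} {B'} C B↭B' = begin
    potential (A ++ B ++ C) + potential B'  ≡⟨ cong (_+ potential B') (potential-middle A B C) ⟩
    potential B + rest B + potential B'     ≡⟨ cong (λ r → potential B + r + potential B') (rest-↭) ⟩
    potential B + rest B' + potential B'    ≡⟨ swap-ends (potential B) (rest B') (potential B') ⟩
    potential B' + rest B' + potential B    ≡⟨ cong (_+ potential B) (sym (potential-middle A B' C)) ⟩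
    potential (A ++ B' ++ C) + potential B  ∎
    where
    open ≡-Reasoning
    rest : List Pair → ℕ
    rest X = potential A + crossingsBetween A X + crossingsBetween A C + crossingsBetween X C + potential C
    rest-↭ : rest B ≡ rest B'
    rest-↭ rewrite crossingsBetween-↭ʳ A B↭B' | crossingsBetween-↭ˡ C B↭B' = refl
    swap-ends : ∀ a b c → a + b + c ≡ c + b + a
    swap-ends = solve-∀

module BraidInvariance where

  open Transpositions
  open Labelling
  open CrossingPotential
  open import Data.Nat using (ℕ; zero; suc; _+_; _<_; _≤_; z≤n)
  open import Data.Nat.Properties
    using (≤-trans; n≤1+n; m≤n⇒m≤1+n; m≤m+n; +-monoʳ-≤; +-monoˡ-≤; +-assoc; +-comm; module ≤-Reasoning)
  open import Data.Fin using (toℕ)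
  open import Data.Product using (_,_)
  open import Data.Sum using (_⊎_; inj₁; inj₂)
  open import Data.List using (List; []; _∷_; _++_; map)
  open import Data.List.Properties using (map-++)
  open import Data.List.Relation.Binary.Permutation.Propositional using (_↭_; ↭-sym; ↭-refl)
    renaming (swap to ↭-swap)
  open import Data.List.Relation.Binary.Permutation.Propositional.Properties using (↭-reverse)
  open import Function using (id; _∘_)
  open import Relation.Binary.PropositionalEquality

  record LocalMove (l r : List ℕ) : Set where
    field
      same-labels : ∀ g → labels g l ↭ labels g r
      same-frame  : ∀ g x → after g l x ≡ after g r x
      small       : ∀ g → potential (labels g l) ≤ 1

  labels-split : ∀ f P w S → labels f (P ++ w ++ S) ≡ labels f P ++ labels (after f P) w ++ labels (after (after f P) w) S
  labels-split f P w S = trans (labels-++ f P (w ++ S)) (cong (labels f P ++_) (labels-++ (after f P) w S))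

  local-move-bound : ∀ {l r} → LocalMove l r → ∀ f P S →
    potential (labels f (P ++ l ++ S)) ≤ potential (labels f (P ++ r ++ S)) + 1
  local-move-bound {l} {r} move f P S = begin
    potential (labels f (P ++ l ++ S))         ≡⟨ cong potential (labels-split f P l S) ⟩
    potential (A ++ B ++ C)                    ≤⟨ m≤m+n _ (potential B') ⟩
    potential (A ++ B ++ C) + potential B'     ≡⟨ potential-reorder A C (same-labels g) ⟩
    potential (A ++ B' ++ C) + potential B     ≤⟨ +-monoʳ-≤ _ (small g) ⟩
    potential (A ++ B' ++ C) + 1               ≡⟨ cong (λ L → potential L + 1) (sym labels-r) ⟩
    potential (labels f (P ++ r ++ S)) + 1     ∎
    where
    open LocalMove move
    open ≤-Reasoning
    g = after f P
    A = labels f P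
    B = labels g l
    B' = labels g r
    C = labels (after g l) S
    labels-r : labels f (P ++ r ++ S) ≡ A ++ B' ++ C
    labels-r = trans (labels-split f P r S) (cong (λ T → A ++ B' ++ T) (labels-≗ S (λ x → sym (same-frame g x))))

  labels-braid-up : ∀ g a → labels g (a ∷ suc a ∷ a ∷ [])
    ≡ (g a , g (suc a)) ∷ (g a , g (suc (suc a))) ∷ (g (suc a) , g (suc (suc a))) ∷ []
  labels-braid-up g zero    = refl
  labels-braid-up g (suc a) = trans (labels-map-suc g (a ∷ suc a ∷ a ∷ [])) (labels-braid-up (g ∘ suc) a)

  labels-braid-down : ∀ g a → labels g (suc a ∷ a ∷ suc a ∷ [])
    ≡ (g (suc a) , g (suc (suc a))) ∷ (g a , g (suc (suc a))) ∷ (g a , g (suc a)) ∷ []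
  labels-braid-down g zero    = refl
  labels-braid-down g (suc a) = trans (labels-map-suc g (suc a ∷ a ∷ suc a ∷ [])) (labels-braid-down (g ∘ suc) a)

  labels-distant : ∀ g a b → suc a < b ⊎ suc b < a →
    labels g (a ∷ b ∷ []) ≡ (g a , g (suc a)) ∷ (g b , g (suc b)) ∷ []
  labels-distant g a b distant =
    cong (λ p → (g a , g (suc a)) ∷ p ∷ [])
         (cong₂ _,_ (cong g (swap-outside a b (b-outside distant)))
                    (cong g (swap-outside a (suc b) (1+b-outside distant))))
    where
    b-outside : suc a < b ⊎ suc b < a → b < a ⊎ suc a < b
    b-outside (inj₁ 1+a<b) = inj₂ 1+a<b
    b-outside (inj₂ 1+b<a) = inj₁ (≤-trans (n≤1+n _) 1+b<a)
    1+b-outside : suc a < b ⊎ suc b < a → suc b < a ⊎ suc a < suc b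
    1+b-outside (inj₁ 1+a<b) = inj₂ (m≤n⇒m≤1+n 1+a<b)
    1+b-outside (inj₂ 1+b<a) = inj₁ 1+b<a

  -- Both sides of a relation (I) have the same three labels, in opposite orders and pairwise sharing a value.
  braid-up : ∀ a → LocalMove (a ∷ suc a ∷ a ∷ []) (suc a ∷ a ∷ suc a ∷ [])
  braid-up a = record { same-labels = reversed ; same-frame = λ g x → cong g (swap-braid a x) ; small = no-crossing }
    where
    reversed : ∀ g → labels g (a ∷ suc a ∷ a ∷ []) ↭ labels g (suc a ∷ a ∷ suc a ∷ [])
    reversed g = subst₂ _↭_ (sym (labels-braid-up g a)) (sym (labels-braid-down g a)) (↭-sym (↭-reverse _))
    no-crossing : ∀ g → potential (labels g (a ∷ suc a ∷ a ∷ [])) ≤ 1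
    no-crossing g = subst (_≤ 1) (sym (trans (cong potential (labels-braid-up g a))
                                             (triangle-potential (g a) (g (suc a)) (g (suc (suc a)))))) z≤n

  braid-down : ∀ a → LocalMove (suc a ∷ a ∷ suc a ∷ []) (a ∷ suc a ∷ a ∷ [])
  braid-down a = record { same-labels = reversed ; same-frame = λ g x → cong g (sym (swap-braid a x)) ; small = no-crossing }
    where
    reversed : ∀ g → labels g (suc a ∷ a ∷ suc a ∷ []) ↭ labels g (a ∷ suc a ∷ a ∷ [])
    reversed g = subst₂ _↭_ (sym (labels-braid-down g a)) (sym (labels-braid-up g a)) (↭-sym (↭-reverse _))
    no-crossing : ∀ g → potential (labels g (suc a ∷ a ∷ suc a ∷ [])) ≤ 1
    no-crossing g = subst (_≤ 1) (sym (trans (cong potential (labels-braid-down g a))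
                                             (triangle-potential-reversed (g a) (g (suc a)) (g (suc (suc a)))))) z≤n

  -- The two sides of a relation (II) have the same two labels in opposite orders.
  commute : ∀ a b → suc a < b ⊎ suc b < a → LocalMove (a ∷ b ∷ []) (b ∷ a ∷ [])
  commute a b distant = record
    { same-labels = exchanged
    ; same-frame  = λ g x → cong g (swaps-commute distant x)
    ; small       = λ g → subst (_≤ 1) (cong potential (sym (labels-distant g a b distant)))
                                      (potential-pair (g a , g (suc a)) (g b , g (suc b)))
    }
    where
    flip : suc a < b ⊎ suc b < a → suc b < a ⊎ suc a < b
    flip (inj₁ h) = inj₂ h
    flip (inj₂ h) = inj₁ h
    swaps-commute : suc a < b ⊎ suc b < a → ∀ x → swap a (swap b x) ≡ swap b (swap a x)
    swaps-commute (inj₁ 1+a<b) x = sym (swap-commute a b x 1+a<b)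
    swaps-commute (inj₂ 1+b<a) x = swap-commute b a x 1+b<a
    exchanged : ∀ g → labels g (a ∷ b ∷ []) ↭ labels g (b ∷ a ∷ [])
    exchanged g = subst₂ _↭_ (sym (labels-distant g a b distant)) (sym (labels-distant g b a (flip distant)))
                             (↭-swap _ _ ↭-refl)

  braid-pair-move : ∀ {n l r} → BraidPair n l r → LocalMove (map toℕ l) (map toℕ r)
  braid-pair-move (rel-I i j (inj₁ i+1≡j)) =
    subst (λ t → LocalMove (toℕ i ∷ t ∷ toℕ i ∷ []) (t ∷ toℕ i ∷ t ∷ [])) i+1≡j (braid-up (toℕ i))
  braid-pair-move (rel-I i j (inj₂ j+1≡i)) =
    subst (λ t → LocalMove (t ∷ toℕ j ∷ t ∷ []) (toℕ j ∷ t ∷ toℕ j ∷ [])) j+1≡i (braid-down (toℕ j))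
  braid-pair-move (rel-II i j distant) = commute (toℕ i) (toℕ j) distant

  crossing-number : List ℕ → ℕ
  crossing-number w = potential (labels id w)

  map-++₃ : ∀ {A B : Set} (f : A → B) P w S → map f (P ++ w ++ S) ≡ map f P ++ map f w ++ map f S
  map-++₃ f P w S = trans (map-++ f P (w ++ S)) (cong (map f P ++_) (map-++ f w S))

  step-bound : ∀ {n u v} → BraidStep n u v → crossing-number (map toℕ u) ≤ crossing-number (map toℕ v) + 1
  step-bound (step P S l r pair) =
    subst₂ (λ u v → crossing-number u ≤ crossing-number v + 1) (sym (map-++₃ toℕ P l S)) (sym (map-++₃ toℕ P r S))
      (local-move-bound (braid-pair-move pair) id (map toℕ P) (map toℕ S))

  path-bound : ∀ {n u v k} → BraidPath n u v k → crossing-number (map toℕ u) ≤ crossing-number (map toℕ v) + k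
  path-bound (done u) = m≤m+n _ 0
  path-bound {u = u} {v} (more {w = w} {k = k} s p) = begin
    crossing-number (map toℕ u)              ≤⟨ step-bound s ⟩
    crossing-number (map toℕ w) + 1          ≤⟨ +-monoˡ-≤ 1 (path-bound p) ⟩
    crossing-number (map toℕ v) + k + 1      ≡⟨ +-assoc (crossing-number (map toℕ v)) k 1 ⟩
    crossing-number (map toℕ v) + (k + 1)    ≡⟨ cong (crossing-number (map toℕ v) +_) (+-comm k 1) ⟩
    crossing-number (map toℕ v) + suc k      ∎
    where open ≤-Reasoning

-- Lower bound on lengths: each letter changes the number of inversions of the one-line notation
-- by at most one, so an expression of the reversal x ↦ n-1-x has at least n(n-1)/2 letters.
module Inversions where

  open Transpositions
  open Labelling using (Bounded)
  open import Data.Nat using (ℕ; zero; suc; _+_; _∸_; _<_; _≤_; _<ᵇ_; z≤n; s≤s)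
  open import Data.Nat.Properties
    using (≤-refl; ≤-reflexive; ≤-trans; m≤m+n; m≤n+m; +-assoc; +-comm; +-suc; +-monoˡ-≤; +-monoʳ-≤;
           <⇒<ᵇ; <ᵇ⇒<; <⇒≱; m∸n≤m; m∸[m∸n]≡n; module ≤-Reasoning)
  open import Data.Nat.ListAction using (sum)
  open import Data.Nat.ListAction.Properties using (sum-↭)
  open import Data.Nat.Tactic.RingSolver using (solve-∀)
  open import Data.Bool using (true; false; if_then_else_)
  open import Data.List using (List; []; _∷_; map; length; applyUpTo)
  open import Data.List.Properties using (length-map)
  open import Data.List.Relation.Unary.All using ([]; _∷_)
  open import Data.List.Relation.Binary.Permutation.Propositional using (_↭_; ↭-refl; prep)
    renaming (swap to ↭-swap)
  open import Data.List.Relation.Binary.Permutation.Propositional.Properties using (map⁺)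
  open import Data.Fin using (toℕ)
  open import Data.Fin.Properties using (toℕ<n)
  open import Data.Empty using (⊥-elim)
  open import Function using (_∘_)
  open import Relation.Binary.PropositionalEquality

  -- The triangular number n(n-1)/2 = C(n,2), the length of the reversal.
  triangle : ℕ → ℕ
  triangle zero    = 0
  triangle (suc n) = n + triangle n

  below : ℕ → List ℕ → ℕ
  below a L = sum (map (λ b → if b <ᵇ a then 1 else 0) L)

  inversions : List ℕ → ℕ
  inversions []      = 0
  inversions (a ∷ L) = below a L + inversions L

  swapAt : ℕ → List ℕ → List ℕ
  swapAt zero    (a ∷ b ∷ L) = b ∷ a ∷ L
  swapAt (suc i) (a ∷ L)     = a ∷ swapAt i L
  swapAt _       L           = L

  swapAt-↭ : ∀ i L → swapAt i L ↭ L
  swapAt-↭ zero    []          = ↭-refl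
  swapAt-↭ zero    (a ∷ [])    = ↭-refl
  swapAt-↭ zero    (a ∷ b ∷ L) = ↭-swap b a ↭-refl
  swapAt-↭ (suc i) []          = ↭-refl
  swapAt-↭ (suc i) (a ∷ L)     = prep a (swapAt-↭ i L)

  indicator≤1 : ∀ b a → (if b <ᵇ a then 1 else 0) ≤ 1
  indicator≤1 b a with b <ᵇ a
  ... | true  = ≤-refl
  ... | false = z≤n

  inversions-swapAt : ∀ i L → inversions (swapAt i L) ≤ inversions L + 1
  inversions-swapAt zero    []          = z≤n
  inversions-swapAt zero    (a ∷ [])    = m≤m+n _ 1
  inversions-swapAt zero    (a ∷ b ∷ L) = begin
    (ab + below b L) + (below a L + inversions L)
      ≤⟨ +-monoˡ-≤ _ (+-monoˡ-≤ (below b L) (≤-trans (indicator≤1 a b) (m≤n+m 1 ba))) ⟩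
    ((ba + 1) + below b L) + (below a L + inversions L) ≡⟨ regroup ba (below b L) (below a L) (inversions L) ⟩
    (ba + below a L) + (below b L + inversions L) + 1   ∎
    where
    open ≤-Reasoning
    ab = if a <ᵇ b then 1 else 0
    ba = if b <ᵇ a then 1 else 0
    regroup : ∀ p q r s → ((p + 1) + q) + (r + s) ≡ (p + r) + (q + s) + 1
    regroup = solve-∀
  inversions-swapAt (suc i) []      = z≤n
  inversions-swapAt (suc i) (a ∷ L) = begin
    below a (swapAt i L) + inversions (swapAt i L)  ≡⟨ cong (_+ inversions (swapAt i L)) (sum-↭ (map⁺ _ (swapAt-↭ i L))) ⟩
    below a L + inversions (swapAt i L)             ≤⟨ +-monoʳ-≤ (below a L) (inversions-swapAt i L) ⟩
    below a L + (inversions L + 1)                  ≡⟨ sym (+-assoc (below a L) (inversions L) 1) ⟩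
    below a L + inversions L + 1                    ∎
    where open ≤-Reasoning

  indicator-< : ∀ {a b} → b < a → (if b <ᵇ a then 1 else 0) ≡ 1
  indicator-< {a} {b} b<a with b <ᵇ a | <⇒<ᵇ b<a
  ... | true  | _  = refl
  ... | false | ()

  indicator-≥ : ∀ {a b} → a ≤ b → (if b <ᵇ a then 1 else 0) ≡ 0
  indicator-≥ {a} {b} a≤b with b <ᵇ a | <ᵇ⇒< b a
  ... | false | _    = refl
  ... | true  | b<a = ⊥-elim (<⇒≱ (b<a _) a≤b)

  applyUpTo-cong : ∀ {A : Set} {h h' : ℕ → A} n → (∀ t → t < n → h t ≡ h' t) → applyUpTo h n ≡ applyUpTo h' n
  applyUpTo-cong zero    h≗h' = refl
  applyUpTo-cong (suc n) h≗h' = cong₂ _∷_ (h≗h' 0 (s≤s z≤n)) (applyUpTo-cong n (λ t t<n → h≗h' (suc t) (s≤s t<n)))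

  applyUpTo-swap : ∀ (h : ℕ → ℕ) i n → suc i < n → applyUpTo (h ∘ swap i) n ≡ swapAt i (applyUpTo h n)
  applyUpTo-swap h zero    (suc zero)    (s≤s ())
  applyUpTo-swap h zero    (suc (suc n)) _         = refl
  applyUpTo-swap h (suc i) (suc n)       (s≤s i<n) = cong (h 0 ∷_)
    (trans (applyUpTo-cong n (λ t _ → cong h (swap-suc i t))) (applyUpTo-swap (h ∘ suc) i n i<n))

  below-none : ∀ a (h : ℕ → ℕ) n → (∀ t → a ≤ h t) → below a (applyUpTo h n) ≡ 0
  below-none a h zero    a≤h = refl
  below-none a h (suc n) a≤h = cong₂ _+_ (indicator-≥ (a≤h 0)) (below-none a (h ∘ suc) n (a≤h ∘ suc))

  below-all : ∀ a (h : ℕ → ℕ) n → (∀ t → t < n → h t < a) → below a (applyUpTo h n) ≡ n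
  below-all a h zero    h<a = refl
  below-all a h (suc n) h<a =
    cong₂ _+_ (indicator-< (h<a 0 (s≤s z≤n))) (below-all a (h ∘ suc) n (λ t t<n → h<a (suc t) (s≤s t<n)))

  inversions-ascending : ∀ m n → inversions (applyUpTo (m +_) n) ≡ 0
  inversions-ascending m zero    = refl
  inversions-ascending m (suc n) = cong₂ _+_ (below-none (m + 0) (λ t → m + suc t) n (λ t → +-monoʳ-≤ m z≤n))
    (trans (cong inversions (applyUpTo-cong n (λ t _ → +-suc m t))) (inversions-ascending (suc m) n))

  reflect-< : ∀ {n t} → t < n → n ∸ suc t < n
  reflect-< {suc n} {t} _ = s≤s (m∸n≤m n t)

  reflect-involutive : ∀ {n t} → t < n → n ∸ suc (n ∸ suc t) ≡ t
  reflect-involutive {suc n} (s≤s t≤n) = m∸[m∸n]≡n t≤n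

  inversions-reversal : ∀ n → inversions (applyUpTo (λ x → n ∸ suc x) n) ≡ triangle n
  inversions-reversal zero    = refl
  inversions-reversal (suc n) =
    cong₂ _+_ (below-all n (λ t → n ∸ suc t) n (λ t → reflect-< {n} {t})) (inversions-reversal n)

  inversions-bound : ∀ n w → Bounded n w → inversions (applyUpTo (actℕ w) n) ≤ length w
  inversions-bound n []      []          = ≤-reflexive (inversions-ascending 0 n)
  inversions-bound n (i ∷ w) (i<n ∷ w<n) = begin
    inversions (applyUpTo (actℕ w ∘ swap i) n)   ≡⟨ cong inversions (applyUpTo-swap (actℕ w) i n i<n) ⟩
    inversions (swapAt i (applyUpTo (actℕ w) n)) ≤⟨ inversions-swapAt i (applyUpTo (actℕ w) n) ⟩
    inversions (applyUpTo (actℕ w) n) + 1        ≤⟨ +-monoˡ-≤ 1 (inversions-bound n w w<n) ⟩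
    length w + 1                                 ≡⟨ +-comm (length w) 1 ⟩
    suc (length w)                               ∎
    where open ≤-Reasoning

  expr-bounded : ∀ n (w : Expr n) → Bounded n (map toℕ w)
  expr-bounded n       []      = []
  expr-bounded zero    (() ∷ w)
  expr-bounded (suc n) (i ∷ w) = s≤s (toℕ<n i) ∷ expr-bounded (suc n) w

  Reverses : ∀ n → Expr n → Set
  Reverses n u = ∀ x → x < n → act {n} u x ≡ n ∸ suc x

  reversal-reduced : ∀ n (u : Expr n) → Reverses n u → length u ≡ triangle n → Reduced n u
  reversal-reduced n u reverses len w u≈w = begin
    length u                                    ≡⟨ len ⟩
    triangle n                                  ≡⟨ sym (inversions-reversal n) ⟩
    inversions (applyUpTo (λ x → n ∸ suc x) n)  ≡⟨ cong inversions (applyUpTo-cong n w-reverses) ⟩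
    inversions (applyUpTo (act {n} w) n)        ≤⟨ inversions-bound n (map toℕ w) (expr-bounded n w) ⟩
    length (map toℕ w)                          ≡⟨ length-map toℕ w ⟩
    length w                                    ∎
    where
    open ≤-Reasoning
    w-reverses : ∀ x → x < n → n ∸ suc x ≡ act {n} w x
    w-reverses x x<n = trans (sym (reverses x x<n)) (u≈w x x<n)

-- Two reduced expressions of the reversal of {0,…,n-1}:
--   U (n+1) = (σ₀ σ₁ ⋯ σ_{n-1}) U n          (carry the first value to the end, then reverse the rest)
--   V (n+1) = (V n shifted up by one) σ₀ ⋯ σ_{n-1}   (reverse positions 1…n, then carry the last value down)
-- Both are bounded words of length n(n-1)/2 reaching the reversed frame.
module ReversalWords where

  open Transpositions
  open Labelling
  open CrossingPotential
  open Inversions using (triangle; reflect-<; reflect-involutive; applyUpTo-cong)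
  open import Data.Nat using (ℕ; zero; suc; _+_; _∸_; _<_; _≤_; z≤n; s≤s)
  open import Data.Nat.Properties
    using (≤-refl; ≤-reflexive; ≤-trans; <⇒≱; n≤1+n; n<1+n; m≤m+n; +-comm; +-suc; +-identityʳ; n∸n≡0;
           m≤n⇒m<n∨m≡n; m<1+n⇒m<n∨m≡n)
  open import Data.Product using (_,_)
  open import Data.Sum using (inj₁; inj₂)
  open import Data.List using (List; []; _∷_; _++_; map; length; applyUpTo)
  open import Data.List.Properties using (length-++; length-map)
  open import Data.List.Relation.Unary.All using ([]; _∷_)
  open import Data.List.Relation.Unary.All.Properties using (++⁺)
  import Data.List.Relation.Unary.All as All
  open import Data.Empty using (⊥-elim)
  open import Function using (id; _∘_)
  open import Relation.Binary.PropositionalEquality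

  ascending : ℕ → ℕ → List ℕ
  ascending m zero    = []
  ascending m (suc k) = m ∷ ascending (suc m) k

  ascending-bounded : ∀ m k n → m + k < n → Bounded n (ascending m k)
  ascending-bounded m zero    n m+k<n = []
  ascending-bounded m (suc k) n m+k<n =
    ≤-trans (s≤s (s≤s (m≤m+n m k))) (subst (_< n) (+-suc m k) m+k<n)
    ∷ ascending-bounded (suc m) k n (subst (_< n) (+-suc m k) m+k<n)

  length-ascending : ∀ m k → length (ascending m k) ≡ k
  length-ascending m zero    = refl
  length-ascending m (suc k) = cong suc (length-ascending (suc m) k)

  after-ascending-below : ∀ f m k x → x < m → after f (ascending m k) x ≡ f x
  after-ascending-below f m zero    x x<m = refl
  after-ascending-below f m (suc k) x x<m =
    trans (after-ascending-below (f ∘ swap m) (suc m) k x (≤-trans x<m (n≤1+n m)))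
          (cong f (swap-outside m x (inj₁ x<m)))

  after-ascending-inside : ∀ f m k x → m ≤ x → x < m + k → after f (ascending m k) x ≡ f (suc x)
  after-ascending-inside f m zero    x m≤x x<m+0 = ⊥-elim (<⇒≱ x<m+0 (subst (_≤ x) (sym (+-identityʳ m)) m≤x))
  after-ascending-inside f m (suc k) x m≤x x<m+k with m≤n⇒m<n∨m≡n m≤x
  ... | inj₂ refl = trans (after-ascending-below (f ∘ swap m) (suc m) k m (n<1+n m)) (cong f (swap-here m))
  ... | inj₁ m<x  =
    trans (after-ascending-inside (f ∘ swap m) (suc m) k x m<x (subst (x <_) (+-suc m k) x<m+k))
          (cong f (swap-outside m (suc x) (inj₂ (s≤s m<x))))

  after-ascending-end : ∀ f m k → after f (ascending m k) (m + k) ≡ f m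
  after-ascending-end f m zero    = cong f (+-identityʳ m)
  after-ascending-end f m (suc k) =
    trans (cong (after (f ∘ swap m) (ascending (suc m) k)) (+-suc m k))
          (trans (after-ascending-end (f ∘ swap m) (suc m) k) (cong f (swap-there m)))

  labels-ascending : ∀ f m k → labels f (ascending m k) ≡ map (f m ,_) (applyUpTo (λ t → f (suc (m + t))) k)
  labels-ascending f m zero    = refl
  labels-ascending f m (suc k) = cong₂ _∷_ (cong (λ z → (f m , f (suc z))) (sym (+-identityʳ m)))
    (trans (labels-ascending (f ∘ swap m) (suc m) k)
           (cong₂ (λ a K → map (a ,_) K) (cong f (swap-there m)) (applyUpTo-cong k (λ t _ → cong f (beyond t)))))
    where
    beyond : ∀ t → swap m (suc (suc m + t)) ≡ suc (m + suc t)
    beyond t = trans (swap-outside m (suc (suc m + t)) (inj₂ (s≤s (s≤s (m≤m+n m t))))) (cong suc (sym (+-suc m t)))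

  U : ℕ → List ℕ
  U zero    = []
  U (suc n) = ascending 0 n ++ U n

  V : ℕ → List ℕ
  V zero    = []
  V (suc n) = map suc (V n) ++ ascending 0 n

  U-bounded : ∀ n → Bounded n (U n)
  U-bounded zero    = []
  U-bounded (suc n) = ++⁺ (ascending-bounded 0 n (suc n) ≤-refl) (All.map (λ h → ≤-trans h (n≤1+n _)) (U-bounded n))

  V-bounded : ∀ n → Bounded n (V n)
  V-bounded zero    = []
  V-bounded (suc n) = ++⁺ (raise (V-bounded n)) (ascending-bounded 0 n (suc n) ≤-refl)
    where
    raise : ∀ {w} → Bounded n w → Bounded (suc n) (map suc w)
    raise []           = []
    raise (i<n ∷ w<n) = s≤s i<n ∷ raise w<n

  length-U : ∀ n → length (U n) ≡ triangle n
  length-U zero    = refl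
  length-U (suc n) = trans (length-++ (ascending 0 n)) (cong₂ _+_ (length-ascending 0 n) (length-U n))

  length-V : ∀ n → length (V n) ≡ triangle n
  length-V zero    = refl
  length-V (suc n) = begin
    length (map suc (V n) ++ ascending 0 n)             ≡⟨ length-++ (map suc (V n)) ⟩
    length (map suc (V n)) + length (ascending 0 n)
      ≡⟨ cong₂ _+_ (trans (length-map suc (V n)) (length-V n)) (length-ascending 0 n) ⟩
    triangle n + n                                      ≡⟨ +-comm (triangle n) n ⟩
    n + triangle n                                      ∎
    where open ≡-Reasoning

  reflect-suc : ∀ {n x} → x < n → suc (n ∸ suc x) ≡ n ∸ x
  reflect-suc {suc n} {zero}  _         = refl
  reflect-suc {suc n} {suc x} (s≤s x<n) = reflect-suc x<n

  after-U : ∀ n x → x < n → after id (U n) x ≡ n ∸ suc x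
  after-U (suc n) x x<1+n with m<1+n⇒m<n∨m≡n x<1+n
  ... | inj₁ x<n = begin
    after id (ascending 0 n ++ U n) x              ≡⟨ cong (λ g → g x) (after-++ id (ascending 0 n) (U n)) ⟩
    after (after id (ascending 0 n)) (U n) x
      ≡⟨ after-cong n (U n) (U-bounded n) (λ y y<n → after-ascending-inside id 0 n y z≤n y<n) x x<n ⟩
    after suc (U n) x                              ≡⟨ after-suc id (U n) x ⟩
    suc (after id (U n) x)                         ≡⟨ cong suc (after-U n x x<n) ⟩
    suc (n ∸ suc x)                                ≡⟨ reflect-suc x<n ⟩
    n ∸ x                                          ∎
    where open ≡-Reasoning
  ... | inj₂ refl = begin
    after id (ascending 0 x ++ U x) x              ≡⟨ cong (λ g → g x) (after-++ id (ascending 0 x) (U x)) ⟩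
    after (after id (ascending 0 x)) (U x) x       ≡⟨ after-above _ x (U x) (U-bounded x) x ≤-refl ⟩
    after id (ascending 0 x) x                     ≡⟨ after-ascending-end id 0 x ⟩
    0                                              ≡⟨ sym (n∸n≡0 x) ⟩
    x ∸ x                                          ∎
    where open ≡-Reasoning

  after-V : ∀ n x → x < n → after id (V n) x ≡ n ∸ suc x
  after-V (suc n) x x<1+n with m<1+n⇒m<n∨m≡n x<1+n
  ... | inj₁ x<n = begin
    after id (map suc (V n) ++ ascending 0 n) x
      ≡⟨ cong (λ g → g x) (after-++ id (map suc (V n)) (ascending 0 n)) ⟩
    after (after id (map suc (V n))) (ascending 0 n) x       ≡⟨ after-ascending-inside _ 0 n x z≤n x<n ⟩
    after id (map suc (V n)) (suc x)                         ≡⟨ after-map-suc id (V n) x ⟩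
    after suc (V n) x                                        ≡⟨ after-suc id (V n) x ⟩
    suc (after id (V n) x)                                   ≡⟨ cong suc (after-V n x x<n) ⟩
    suc (n ∸ suc x)                                          ≡⟨ reflect-suc x<n ⟩
    n ∸ x                                                    ∎
    where open ≡-Reasoning
  ... | inj₂ refl = begin
    after id (map suc (V x) ++ ascending 0 x) x
      ≡⟨ cong (λ g → g x) (after-++ id (map suc (V x)) (ascending 0 x)) ⟩
    after (after id (map suc (V x))) (ascending 0 x) x       ≡⟨ after-ascending-end _ 0 x ⟩
    after id (map suc (V x)) 0                               ≡⟨ after-map-suc-0 id (V x) ⟩
    0                                                        ≡⟨ sym (n∸n≡0 x) ⟩
    x ∸ x                                                    ∎
    where open ≡-Reasoning

  reverses-from-after : ∀ n w → (∀ x → x < n → after id w x ≡ n ∸ suc x) →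
                        ∀ x → x < n → actℕ w x ≡ n ∸ suc x
  reverses-from-after n w reaches x x<n = begin
    actℕ w x                                     ≡⟨ cong (actℕ w) (sym (reflect-involutive x<n)) ⟩
    actℕ w (n ∸ suc (n ∸ suc x))                 ≡⟨ cong (actℕ w) (sym (reaches (n ∸ suc x) (reflect-< x<n))) ⟩
    actℕ w (after id w (n ∸ suc x))              ≡⟨ act-after w (n ∸ suc x) ⟩
    n ∸ suc x                                    ∎
    where open ≡-Reasoning

-- Crossing numbers of the two expressions: reading off their labels recursively, V n has crossing
-- number 0, while U (m+2) gains (m+1)·C(m,2) crossings over U (m+1), between the new first row of
-- labels (0 , t+1) and the shifted labels of U (m+1) avoiding t+1.
module ReversalCrossings where

  open Labelling
  open CrossingPotential
  open Inversions using (triangle)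
  open BraidInvariance using (crossing-number)
  open ReversalWords
  open import Data.Nat using (ℕ; zero; suc; _+_; _*_; _∸_; _<_; _≤_; _≡ᵇ_; z≤n; s≤s)
  open import Data.Nat.Properties using (≤-pred)
  open import Data.Product using (_,_)
  open import Data.List using (List; []; _∷_; _++_; map; length; applyUpTo)
  open import Data.List.Properties using (map-++; map-applyUpTo)
  open import Data.Nat.ListAction using (sum)
  open import Data.Nat.ListAction.Properties using (sum-++)
  open import Data.Bool using (if_then_else_; not; _∨_)
  open import Function using (id; _∘_)
  open import Relation.Binary.PropositionalEquality

  column : List ℕ → List Pair
  column = map (0 ,_)

  labels-U-suc : ∀ n → labels id (U (suc n)) ≡ column (applyUpTo suc n) ++ map shift (labels id (U n))
  labels-U-suc n = begin
    labels id (ascending 0 n ++ U n)                             ≡⟨ labels-++ id (ascending 0 n) (U n) ⟩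
    labels id (ascending 0 n) ++ labels (after id (ascending 0 n)) (U n)
      ≡⟨ cong₂ _++_ (labels-ascending id 0 n)
                    (labels-cong n (U n) (U-bounded n) (λ y y<n → after-ascending-inside id 0 n y z≤n y<n)) ⟩
    column (applyUpTo suc n) ++ labels suc (U n)                 ≡⟨ cong (column (applyUpTo suc n) ++_) (labels-suc id (U n)) ⟩
    column (applyUpTo suc n) ++ map shift (labels id (U n))      ∎
    where open ≡-Reasoning

  labels-V-suc : ∀ n → labels id (V (suc n))
    ≡ map shift (labels id (V n)) ++ column (applyUpTo (λ t → after id (map suc (V n)) (suc t)) n)
  labels-V-suc n = begin
    labels id (map suc (V n) ++ ascending 0 n)                   ≡⟨ labels-++ id (map suc (V n)) (ascending 0 n) ⟩
    labels id (map suc (V n)) ++ labels h (ascending 0 n)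
      ≡⟨ cong₂ _++_ (trans (labels-map-suc id (V n)) (labels-suc id (V n))) (labels-ascending h 0 n) ⟩
    map shift (labels id (V n)) ++ map (h 0 ,_) (applyUpTo (h ∘ suc) n)
      ≡⟨ cong (λ a → map shift (labels id (V n)) ++ map (a ,_) (applyUpTo (h ∘ suc) n)) (after-map-suc-0 id (V n)) ⟩
    map shift (labels id (V n)) ++ column (applyUpTo (h ∘ suc) n) ∎
    where
    open ≡-Reasoning
    h = after id (map suc (V n))

  potential-column : ∀ K → potential (column K) ≡ 0
  potential-column []      = refl
  potential-column (k ∷ K) = trans (cong (_+ potential (column K)) (within k K)) (potential-column K)
    where
    within : ∀ k K → crossingsFrom (0 , k) (column K) ≡ 0
    within k []      = refl
    within k (j ∷ K) = within k K

  crossingsBetween-shift-column : ∀ L K → crossingsBetween (map shift L) (column K) ≡ 0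
  crossingsBetween-shift-column []      K = refl
  crossingsBetween-shift-column (p ∷ L) K = cong₂ _+_ (into p K) (crossingsBetween-shift-column L K)
    where
    into : ∀ p K → crossingsFrom (shift p) (column K) ≡ 0
    into p       []      = refl
    into (a , b) (k ∷ K) = into (a , b) K

  potential-shift : ∀ L → potential (map shift L) ≡ potential L
  potential-shift []      = refl
  potential-shift (p ∷ L) = cong₂ _+_ (from p L) (potential-shift L)
    where
    from : ∀ p L → crossingsFrom (shift p) (map shift L) ≡ crossingsFrom p L
    from p       []            = refl
    from (a , b) ((c , d) ∷ L) = cong (crosses (a , b) (c , d) +_) (from (a , b) L)

  misses : ℕ → Pair → ℕ
  misses e (c , d) = if not ((e ≡ᵇ c) ∨ (e ≡ᵇ d)) then 1 else 0

  avoiding : ℕ → List Pair → ℕ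
  avoiding e L = sum (map (misses e) L)

  avoiding-++ : ∀ e A B → avoiding e (A ++ B) ≡ avoiding e A + avoiding e B
  avoiding-++ e A B = trans (cong sum (map-++ (misses e) A B)) (sum-++ (map (misses e) A) _)

  avoiding-shift : ∀ e L → avoiding (suc e) (map shift L) ≡ avoiding e L
  avoiding-shift e []            = refl
  avoiding-shift e ((c , d) ∷ L) = cong (misses e (c , d) +_) (avoiding-shift e L)

  avoiding-0-shift : ∀ L → avoiding 0 (map shift L) ≡ length L
  avoiding-0-shift []      = refl
  avoiding-0-shift (p ∷ L) = cong suc (avoiding-0-shift L)

  avoiding-0-column : ∀ K → avoiding 0 (column K) ≡ 0
  avoiding-0-column []      = refl
  avoiding-0-column (k ∷ K) = avoiding-0-column K

  avoiding-first-row : ∀ e m → e < m → avoiding (suc e) (column (applyUpTo suc m)) ≡ m ∸ 1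
  avoiding-first-row e m e<m =
    trans (cong sum (trans (cong (map (misses (suc e))) (map-applyUpTo suc (0 ,_) m))
                           (map-applyUpTo _ (misses (suc e)) m)))
          (others e m e<m)
    where
    ones : ∀ m → sum (applyUpTo (λ _ → 1) m) ≡ m
    ones zero    = refl
    ones (suc m) = cong suc (ones m)
    others : ∀ e m → e < m → sum (applyUpTo (λ t → if not (e ≡ᵇ t) then 1 else 0) m) ≡ m ∸ 1
    others zero    (suc m)       _                 = ones m
    others (suc e) (suc zero)    (s≤s ())
    others (suc e) (suc (suc m)) (s≤s e<1+m)       = cong suc (others e (suc m) e<1+m)

  -- The labels of U (m+1) are all pairs of values below m+1; m(m-1)/2 of them avoid a given value.
  avoiding-U : ∀ m e → e ≤ m → avoiding e (labels id (U (suc m))) ≡ triangle m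
  avoiding-U m zero _ = begin
    avoiding 0 (labels id (U (suc m)))                                           ≡⟨ cong (avoiding 0) (labels-U-suc m) ⟩
    avoiding 0 (column (applyUpTo suc m) ++ map shift (labels id (U m)))         ≡⟨ avoiding-++ 0 (column (applyUpTo suc m)) _ ⟩
    avoiding 0 (column (applyUpTo suc m)) + avoiding 0 (map shift (labels id (U m)))
      ≡⟨ cong₂ _+_ (avoiding-0-column (applyUpTo suc m)) (avoiding-0-shift (labels id (U m))) ⟩
    length (labels id (U m))                                                     ≡⟨ length-labels id (U m) ⟩
    length (U m)                                                                 ≡⟨ length-U m ⟩
    triangle m                                                                   ∎
    where open ≡-Reasoning
  avoiding-U (suc m) (suc e) (s≤s e≤m) = begin
    avoiding (suc e) (labels id (U (suc (suc m))))                               ≡⟨ cong (avoiding (suc e)) (labels-U-suc (suc m)) ⟩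
    avoiding (suc e) (column (applyUpTo suc (suc m)) ++ map shift (labels id (U (suc m))))
      ≡⟨ avoiding-++ (suc e) (column (applyUpTo suc (suc m))) _ ⟩
    avoiding (suc e) (column (applyUpTo suc (suc m))) + avoiding (suc e) (map shift (labels id (U (suc m))))
      ≡⟨ cong₂ _+_ (avoiding-first-row e (suc m) (s≤s e≤m))
                   (trans (avoiding-shift e (labels id (U (suc m)))) (avoiding-U m e e≤m)) ⟩
    m + triangle m                                                               ∎
    where open ≡-Reasoning

  crossingsFrom-corner : ∀ e L → crossingsFrom (0 , suc e) (map shift L) ≡ avoiding e L
  crossingsFrom-corner e []            = refl
  crossingsFrom-corner e ((c , d) ∷ L) = cong (misses e (c , d) +_) (crossingsFrom-corner e L)

  sum-constant : ∀ (h : ℕ → ℕ) n c → (∀ t → t < n → h t ≡ c) → sum (applyUpTo h n) ≡ n * c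
  sum-constant h zero    c h≡c = refl
  sum-constant h (suc n) c h≡c =
    cong₂ _+_ (h≡c 0 (s≤s z≤n)) (sum-constant (h ∘ suc) n c (λ t t<n → h≡c (suc t) (s≤s t<n)))

  crossing-V : ∀ n → crossing-number (V n) ≡ 0
  crossing-V zero    = refl
  crossing-V (suc n) = begin
    potential (labels id (V (suc n)))                     ≡⟨ cong potential (labels-V-suc n) ⟩
    potential (map shift L ++ column K)                   ≡⟨ potential-++ (map shift L) (column K) ⟩
    potential (map shift L) + crossingsBetween (map shift L) (column K) + potential (column K)
      ≡⟨ cong₂ _+_ (cong₂ _+_ (trans (potential-shift L) (crossing-V n)) (crossingsBetween-shift-column L K))
                   (potential-column K) ⟩
    0                                                     ∎
    where
    open ≡-Reasoning
    L = labels id (V n)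
    K = applyUpTo (λ t → after id (map suc (V n)) (suc t)) n

  crossing-U-step : ∀ m → crossing-number (U (suc (suc m))) ≡ suc m * triangle m + crossing-number (U (suc m))
  crossing-U-step m = begin
    potential (labels id (U (suc (suc m))))               ≡⟨ cong potential (labels-U-suc (suc m)) ⟩
    potential (column K ++ map shift L)                   ≡⟨ potential-++ (column K) (map shift L) ⟩
    potential (column K) + crossingsBetween (column K) (map shift L) + potential (map shift L)
      ≡⟨ cong₂ _+_ (cong (_+ crossingsBetween (column K) (map shift L)) (potential-column K)) (potential-shift L) ⟩
    crossingsBetween (column K) (map shift L) + potential L
      ≡⟨ cong (_+ potential L) first-row ⟩
    suc m * triangle m + potential L                      ∎
    where
    open ≡-Reasoning
    K = applyUpTo suc (suc m)
    L = labels id (U (suc m))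
    first-row : crossingsBetween (column K) (map shift L) ≡ suc m * triangle m
    first-row = begin
      sum (map (λ p → crossingsFrom p (map shift L)) (map (0 ,_) K))
        ≡⟨ cong (sum ∘ map _) (map-applyUpTo suc (0 ,_) (suc m)) ⟩
      sum (map (λ p → crossingsFrom p (map shift L)) (applyUpTo (λ t → (0 , suc t)) (suc m)))
        ≡⟨ cong sum (map-applyUpTo (λ t → (0 , suc t)) (λ p → crossingsFrom p (map shift L)) (suc m)) ⟩
      sum (applyUpTo (λ t → crossingsFrom (0 , suc t) (map shift L)) (suc m))
        ≡⟨ sum-constant _ (suc m) (triangle m)
                        (λ t t<1+m → trans (crossingsFrom-corner t L) (avoiding-U m t (≤-pred t<1+m))) ⟩
      suc m * triangle m ∎

-- A sequence growing by (m+1)·C(m,2) from m+1 to m+2 is 3·C(n,4) = (n⁴ - 6n³ + 11n² - 6n)/8.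
module QuarticGrowth where

  open Inversions using (triangle)
  open import Data.Nat using (ℕ; zero; suc; _+_; _*_; _^_; _≤_; z≤n)
  open import Data.Nat.Properties using (+-cancelʳ-≡; +-cancelʳ-≤; +-monoʳ-≤; *-mono-≤; m≤m+n; m≤m*n; module ≤-Reasoning)
  open import Data.Nat.Tactic.RingSolver using (solve-∀)
  open import Relation.Binary.PropositionalEquality

  triangle-double : ∀ k → 2 * triangle k + k ≡ k * k
  triangle-double zero    = refl
  triangle-double (suc k) = begin
    2 * (k + triangle k) + suc k   ≡⟨ expand k (triangle k) ⟩
    (2 * triangle k + k) + 2 * k + 1  ≡⟨ cong (λ z → z + 2 * k + 1) (triangle-double k) ⟩
    k * k + 2 * k + 1              ≡⟨ square k ⟩
    suc k * suc k                  ∎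
    where
    open ≡-Reasoning
    expand : ∀ k t → 2 * (k + t) + suc k ≡ (2 * t + k) + 2 * k + 1
    expand = solve-∀
    square : ∀ k → k * k + 2 * k + 1 ≡ suc k * suc k
    square = solve-∀

  -- The two polynomial identities behind the inductive step of `quartic-closed-form`, with the powers
  -- x ^ 2, x ^ 3, x ^ 4 written out as x * (x * 1), … (the ring solver does not read _^_).
  regroup : ∀ k p q →
    8 * ((1 + k) * q + p) + 6 * ((2 + k) * ((2 + k) * ((2 + k) * 1))) + 6 * (2 + k)
      + (4 * (1 + k) * k + 6 * ((1 + k) * ((1 + k) * ((1 + k) * 1))) + 6 * (1 + k))
    ≡ 4 * (1 + k) * (2 * q + k) + (8 * p + 6 * ((1 + k) * ((1 + k) * ((1 + k) * 1))) + 6 * (1 + k))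
      + 6 * ((2 + k) * ((2 + k) * ((2 + k) * 1))) + 6 * (2 + k)
  regroup = solve-∀

  finish : ∀ k →
    4 * (1 + k) * (k * k) + ((1 + k) * ((1 + k) * ((1 + k) * ((1 + k) * 1))) + 11 * ((1 + k) * ((1 + k) * 1)))
      + 6 * ((2 + k) * ((2 + k) * ((2 + k) * 1))) + 6 * (2 + k)
    ≡ (2 + k) * ((2 + k) * ((2 + k) * ((2 + k) * 1))) + 11 * ((2 + k) * ((2 + k) * 1))
      + (4 * (1 + k) * k + 6 * ((1 + k) * ((1 + k) * ((1 + k) * 1))) + 6 * (1 + k))
  finish = solve-∀

  module _ (f : ℕ → ℕ) (f0 : f 0 ≡ 0) (f1 : f 1 ≡ 0)
           (step : ∀ m → f (suc (suc m)) ≡ suc m * triangle m + f (suc m)) where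

    quartic-closed-form : ∀ n → 8 * f n + 6 * n ^ 3 + 6 * n ≡ n ^ 4 + 11 * n ^ 2
    quartic-closed-form zero          rewrite f0 = refl
    quartic-closed-form (suc zero)    rewrite f1 = refl
    quartic-closed-form (suc (suc k)) = +-cancelʳ-≡ _ _ _ (begin
      8 * f (2 + k) + 6 * (2 + k) ^ 3 + 6 * (2 + k) + E
        ≡⟨ cong (λ z → 8 * z + 6 * (2 + k) ^ 3 + 6 * (2 + k) + E) (step k) ⟩
      8 * ((1 + k) * triangle k + f (1 + k)) + 6 * (2 + k) ^ 3 + 6 * (2 + k) + E
        ≡⟨ regroup k (f (1 + k)) (triangle k) ⟩
      4 * (1 + k) * (2 * triangle k + k) + (8 * f (1 + k) + 6 * (1 + k) ^ 3 + 6 * (1 + k)) + 6 * (2 + k) ^ 3 + 6 * (2 + k)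
        ≡⟨ cong₂ (λ a b → 4 * (1 + k) * a + b + 6 * (2 + k) ^ 3 + 6 * (2 + k))
                 (triangle-double k) (quartic-closed-form (suc k)) ⟩
      4 * (1 + k) * (k * k) + ((1 + k) ^ 4 + 11 * (1 + k) ^ 2) + 6 * (2 + k) ^ 3 + 6 * (2 + k)
        ≡⟨ finish k ⟩
      (2 + k) ^ 4 + 11 * (2 + k) ^ 2 + E ∎)
      where
      open ≡-Reasoning
      E = 4 * (1 + k) * k + 6 * (1 + k) ^ 3 + 6 * (1 + k)

    quartic-bound : ∀ n → n ^ 4 ≤ 8 * f n + 6 * n ^ 3
    quartic-bound n = +-cancelʳ-≤ (6 * n) _ _ (begin
      n ^ 4 + 6 * n               ≤⟨ +-monoʳ-≤ (n ^ 4) (*-mono-≤ {6} {11} (m≤m+n 6 5) (n≤n² n)) ⟩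
      n ^ 4 + 11 * n ^ 2          ≡⟨ sym (quartic-closed-form n) ⟩
      8 * f n + 6 * n ^ 3 + 6 * n ∎)
      where
      open ≤-Reasoning
      n≤n² : ∀ n → n ≤ n ^ 2
      n≤n² zero    = z≤n
      n≤n² (suc n) = m≤m*n (suc n) (suc n * 1)

module FarApartExpressions where

  open Labelling using (Bounded; after)
  open BraidInvariance using (crossing-number; path-bound)
  open Inversions using (triangle; Reverses; reversal-reduced)
  open ReversalWords
  open ReversalCrossings using (crossing-V; crossing-U-step)
  open QuarticGrowth using (quartic-bound)
  open import Data.Nat using (zero; suc; _+_; _*_; _^_; _∸_; _<_; _≤_; s≤s)
  open import Data.Nat.Properties using (+-mono-≤; *-monoʳ-≤; *-monoˡ-≤; m≤m+n; module ≤-Reasoning)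
  open import Data.Fin using (toℕ; fromℕ<)
  open import Data.Fin.Properties using (toℕ-fromℕ<)
  open import Data.Product using (Σ; _×_; _,_; proj₁; proj₂)
  open import Data.List using ([]; _∷_; map; length)
  open import Data.List.Properties using (length-map)
  open import Data.List.Relation.Unary.All using ([]; _∷_)
  open import Function using (id; _∘_)
  open import Relation.Binary.PropositionalEquality

  toExpr : ∀ n w → Bounded n w → Expr n
  toExpr n       []      []                = []
  toExpr zero    (i ∷ w) (() ∷ _)
  toExpr (suc n) (i ∷ w) (s≤s i<n ∷ w<1+n) = fromℕ< i<n ∷ toExpr (suc n) w w<1+n

  toExpr-letters : ∀ n w (w<n : Bounded n w) → map toℕ (toExpr n w w<n) ≡ w
  toExpr-letters n       []      []                = refl
  toExpr-letters (suc n) (i ∷ w) (s≤s i<n ∷ w<1+n) = cong₂ _∷_ (toℕ-fromℕ< i<n) (toExpr-letters (suc n) w w<1+n)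

  reduced-reversal : ∀ n w (w<n : Bounded n w) → (∀ x → x < n → after id w x ≡ n ∸ suc x) → length w ≡ triangle n →
    Reverses n (toExpr n w w<n) × Reduced n (toExpr n w w<n)
  reduced-reversal n w w<n reaches len = reverses , reversal-reduced n (toExpr n w w<n) reverses length-triangle
    where
    letters = toExpr-letters n w w<n
    reverses : Reverses n (toExpr n w w<n)
    reverses x x<n = trans (cong (λ v → actℕ v x) letters) (reverses-from-after n w reaches x x<n)
    length-triangle : length (toExpr n w w<n) ≡ triangle n
    length-triangle = trans (sym (length-map toℕ (toExpr n w w<n))) (trans (cong length letters) len)

  far-apart : ∀ n → Σ (Expr n) λ u → Σ (Expr n) λ v →
      Reduced n u × Reduced n v × Equivalent n u v × (∀ k → BraidPath n u v k → n ^ 4 ≤ 8 * k + 8 * n ^ 3)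
  far-apart n = toExpr n (U n) (U-bounded n) , toExpr n (V n) (V-bounded n) ,
                proj₂ U-reversal , proj₂ V-reversal , equivalent , distance
    where
    U-reversal = reduced-reversal n (U n) (U-bounded n) (after-U n) (length-U n)
    V-reversal = reduced-reversal n (V n) (V-bounded n) (after-V n) (length-V n)
    equivalent : Equivalent n (toExpr n (U n) (U-bounded n)) (toExpr n (V n) (V-bounded n))
    equivalent x x<n = trans (proj₁ U-reversal x x<n) (sym (proj₁ V-reversal x x<n))
    distance : ∀ k → BraidPath n (toExpr n (U n) (U-bounded n)) (toExpr n (V n) (V-bounded n)) k → n ^ 4 ≤ 8 * k + 8 * n ^ 3
    distance k path = begin
      n ^ 4                                 ≤⟨ quartic-bound (crossing-number ∘ U) refl refl crossing-U-step n ⟩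
      8 * crossing-number (U n) + 6 * n ^ 3 ≤⟨ +-mono-≤ (*-monoʳ-≤ 8 crossings≤k) (*-monoˡ-≤ (n ^ 3) 6≤8) ⟩
      8 * k + 8 * n ^ 3                     ∎
      where
      open ≤-Reasoning
      6≤8 : 6 ≤ 8
      6≤8 = m≤m+n 6 2
      crossings≤k : crossing-number (U n) ≤ k
      crossings≤k = subst₂ (λ a b → crossing-number a ≤ b + k)
                           (toExpr-letters n (U n) (U-bounded n))
                           (trans (cong crossing-number (toExpr-letters n (V n) (V-bounded n))) (crossing-V n))
                           (path-bound path)

module RationalBound where

  open import Data.Nat as ℕ using (ℕ)
  open import Data.Integer as ℤ using (+_)
  import Data.Integer.Properties as ℤ
  open import Data.Integer.Tactic.RingSolver using (solve-∀)
  open import Data.Rational as ℚ using (ℚ; _/_)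
  import Data.Rational.Properties as ℚ
  import Data.Rational.Unnormalised as ℚᵘ
  import Data.Rational.Unnormalised.Properties as ℚᵘ
  open import Relation.Binary.PropositionalEquality

  -- The same inequality, cleared of denominators, as it arises in unnormalised rationals.
  integer-bound : ∀ a b k → a ℕ.≤ 8 ℕ.* k ℕ.+ 8 ℕ.* b →
    ((+ a) ℤ.* (+ 1) ℤ.+ (ℤ.- (+ b)) ℤ.* (+ 8)) ℤ.* (+ 1) ℤ.≤ (+ k) ℤ.* (+ 8)
  integer-bound a b k a≤8k+8b = begin
    ((+ a) ℤ.* (+ 1) ℤ.+ (ℤ.- (+ b)) ℤ.* (+ 8)) ℤ.* (+ 1)  ≡⟨ clear (+ a) (+ b) ⟩
    (+ a) ℤ.- (+ b) ℤ.* (+ 8)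
      ≤⟨ ℤ.+-monoˡ-≤ (ℤ.- ((+ b) ℤ.* (+ 8))) (ℤ.+≤+ a≤8k+8b) ⟩
    + (8 ℕ.* k ℕ.+ 8 ℕ.* b) ℤ.- (+ b) ℤ.* (+ 8)
      ≡⟨ cong (ℤ._- (+ b) ℤ.* (+ 8)) (trans (ℤ.pos-+ (8 ℕ.* k) (8 ℕ.* b)) (cong₂ ℤ._+_ (ℤ.pos-* 8 k) (ℤ.pos-* 8 b))) ⟩
    ((+ 8) ℤ.* (+ k) ℤ.+ (+ 8) ℤ.* (+ b)) ℤ.- (+ b) ℤ.* (+ 8) ≡⟨ cancel (+ k) (+ b) ⟩
    (+ k) ℤ.* (+ 8)                                          ∎
    where
    open ℤ.≤-Reasoning
    clear : ∀ A B → (A ℤ.* (+ 1) ℤ.+ (ℤ.- B) ℤ.* (+ 8)) ℤ.* (+ 1) ≡ A ℤ.- B ℤ.* (+ 8)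
    clear = solve-∀
    cancel : ∀ K B → ((+ 8) ℤ.* K ℤ.+ (+ 8) ℤ.* B) ℤ.- B ℤ.* (+ 8) ≡ K ℤ.* (+ 8)
    cancel = solve-∀

  rational-bound : ∀ a b k → a ℕ.≤ 8 ℕ.* k ℕ.+ 8 ℕ.* b → ((+ a) / 8) ℚ.+ ℚ.- ((+ b) / 1) ℚ.≤ (+ k) / 1
  rational-bound a b k a≤8k+8b =
    ℚ.toℚᵘ-cancel-≤ (ℚᵘ.≤-respʳ-≃ (ℚᵘ.≃-sym rhs)
                      (ℚᵘ.≤-respˡ-≃ (ℚᵘ.≃-sym lhs) (ℚᵘ.*≤* (integer-bound a b k a≤8k+8b))))
    where
    lhs : ℚ.toℚᵘ (((+ a) / 8) ℚ.+ ℚ.- ((+ b) / 1)) ℚᵘ.≃ (ℚᵘ.mkℚᵘ (+ a) 7 ℚᵘ.+ ℚᵘ.- ℚᵘ.mkℚᵘ (+ b) 0)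
    lhs = ℚᵘ.≃-trans (ℚ.toℚᵘ-homo-+ ((+ a) / 8) (ℚ.- ((+ b) / 1)))
            (ℚᵘ.+-cong (ℚ.toℚᵘ-fromℚᵘ (ℚᵘ.mkℚᵘ (+ a) 7))
                       (ℚᵘ.≃-trans (ℚ.toℚᵘ-homo‿- ((+ b) / 1))
                                   (ℚᵘ.-‿cong (ℚ.toℚᵘ-fromℚᵘ (ℚᵘ.mkℚᵘ (+ b) 0)))))
    rhs : ℚ.toℚᵘ ((+ k) / 1) ℚᵘ.≃ ℚᵘ.mkℚᵘ (+ k) 0
    rhs = ℚ.toℚᵘ-fromℚᵘ (ℚᵘ.mkℚᵘ (+ k) 0)

  abs-neg-bound : ∀ m → ℚ.∣ ℚ.- ((+ m) / 1) ∣ ℚ.≤ ℚ.1ℚ ℚ.* ((+ m) / 1)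
  abs-neg-bound m =
    ℚ.≤-reflexive (trans (ℚ.∣-p∣≡∣p∣ q) (trans (ℚ.0≤p⇒∣p∣≡p 0≤q) (sym (ℚ.*-identityˡ q))))
    where
    q = (+ m) / 1
    0≤q : ℚ.0ℚ ℚ.≤ q
    0≤q = ℚ.nonNegative⁻¹ q {{ℚ.normalize-nonNeg m 1}}

open import Data.Nat using (ℕ; _≤_; _^_)
open import Data.Integer using (+_)
open import Data.Rational using (ℚ; _/_; _+_; _*_; ∣_∣; -_; 1ℚ) renaming (_≤_ to _≤ℚ_)
open import Data.Product using (Σ; _×_; _,_)
open FarApartExpressions using (far-apart)
open RationalBound using (rational-bound; abs-neg-bound)

corollary1p12 : Σ (ℕ → ℚ) λ g →
    (Σ ℚ λ C → Σ ℕ λ N → ∀ n → N ≤ n → ∣ g n ∣ ≤ℚ C * ((+ (n ^ 3)) / 1))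
  × (∀ n → Σ (Expr n) λ u → Σ (Expr n) λ v →
        Reduced n u × Reduced n v × Equivalent n u v
      × (∀ k → BraidPath n u v k → ((+ (n ^ 4)) / 8) + g n ≤ℚ (+ k) / 1))
corollary1p12 = g , (1ℚ , 0 , λ n _ → abs-neg-bound (n ^ 3)) , far-apart-ℚ
  where
  g : ℕ → ℚ
  g n = - ((+ (n ^ 3)) / 1)
  far-apart-ℚ : ∀ n → Σ (Expr n) λ u → Σ (Expr n) λ v → Reduced n u × Reduced n v × Equivalent n u v
      × (∀ k → BraidPath n u v k → ((+ (n ^ 4)) / 8) + g n ≤ℚ (+ k) / 1)
  far-apart-ℚ n with far-apart n
  ... | u , v , u-reduced , v-reduced , u≈v , distance =
    u , v , u-reduced , v-reduced , u≈v , λ k path → rational-bound (n ^ 4) (n ^ 3) k (distance k path)
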